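{- Let $d\ge 2$ (in the paper $d\ge3$ is of interest) and let $\prec$ be any strict total order on $\mathbb{Z}$. For $p,q\in\mathbb{Z}^d$ with $p\le q$ coordinatewise, let $S_\prec(p,q)$ be defined as in the context, and set $S_\prec(q,p)=S_\prec(p,q)$. Then this system of segments with strictly positive slope is consistent: (S1) each $S_\prec(p,q)$ is the vertex set of a path from $p$ to $q$ in the grid graph on $\mathbb{Z}^d$; (S2) $S_\prec(p,q)=S_\prec(q,p)$; (S3) for $p\le q$ and every $r\in S_\prec(p,q)$, $S_\prec(p,r)\subseteq S_\prec(p,q)$ and $S_\prec(r,q)\subseteq S_\prec(p,q)$; (S4) for $p\le q$ there is $r\ge q$ with $r\notin S_\prec(p,q)$ and $S_\prec(p,q)\subseteq S_\prec(p,r)$, and there is $r'\le p$ with $r'\notin S_\prec(p,q)$ and $S_\prec(p,q)\subseteq S_\prec(r',q)$; (S5) if $p_i=q_i$ for some $i$, then every $r\in S_\prec(p,q)$ has $r_i=p_i$.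
   Context: The grid graph on $\mathbb{Z}^d$ joins two points iff they differ by exactly $1$ in exactly one coordinate. For $p=(p_1,\dots,p_d)\le q=(q_1,\dots,q_d)$ (coordinatewise), $S_\prec(p,q)$ is the set of points visited by the following walk: start at $p$ and repeatedly move by $+1$ in one coordinate ("direction $i$") until reaching $q$. The segment interval is $I=[p_1+\dots+p_d,\ q_1+\dots+q_d-1]$; partition $I$ according to $\prec$ into consecutive blocks: $I_d$ = the $q_d-p_d$ $\prec$-greatest elements of $I$, $I_{d-1}$ = the $q_{d-1}-p_{d-1}$ $\prec$-greatest elements of $I\setminus I_d$, and so on, down to $I_1$ = the remaining $q_1-p_1$ ($\prec$-smallest) elements. At a point $(r_1,\dots,r_d)$ the walk moves in direction $i$ where $r_1+\dots+r_d\in I_i$. -}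

module Defs where

open import Level using (0ℓ)
open import Data.Nat as ℕ using (ℕ; zero; suc)
open import Data.Integer as ℤ using (ℤ; +_; ∣_∣; _-_)
open import Data.Fin using (Fin; zero; suc)
open import Data.Vec using (Vec; lookup; tabulate)
open import Data.Product using (Σ; ∃; _×_; _,_)
open import Data.Sum using (_⊎_)
open import Relation.Nullary using (Dec; yes; no; ¬_)
open import Relation.Nullary.Decidable using (_×-dec_)
open import Relation.Binary using (Rel; Decidable)
open import Relation.Binary.PropositionalEquality using (_≡_; _≢_)

Pt : ℕ → Set
Pt d = Vec ℤ d

_≤ₚ_ : ∀ {d} → Pt d → Pt d → Set
p ≤ₚ q = ∀ i → lookup p i ℤ.≤ lookup q i

Adj : ∀ {d} → Pt d → Pt d → Set
Adj {d} a b = Σ (Fin d) λ i → (∣ lookup a i - lookup b i ∣ ≡ 1) × (∀ j → j ≢ i → lookup a j ≡ lookup b j)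

sumℤ : ∀ {d} → (Fin d → ℤ) → ℤ
sumℤ {zero} f = + 0
sumℤ {suc d} f = f zero ℤ.+ sumℤ (λ i → f (suc i))

sumℕ : ∀ {d} → (Fin d → ℕ) → ℕ
sumℕ {zero} f = 0
sumℕ {suc d} f = f zero ℕ.+ sumℕ (λ i → f (suc i))

cum : ∀ {d} → (Fin d → ℕ) → Fin d → ℕ
cum lens zero = 0
cum lens (suc i) = lens zero ℕ.+ cum (λ j → lens (suc j)) i

count : ℕ → {P : ℕ → Set} → ((j : ℕ) → Dec (P j)) → ℕ
count zero P? = 0
count (suc n) P? with P? n
... | yes _ = suc (count n P?)
... | no  _ = count n P?

module Walk {_≺_ : Rel ℤ 0ℓ} (_≺?_ : Decidable _≺_) {d : ℕ} (p q : Pt d) where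

  len : Fin d → ℕ
  len i = ∣ lookup q i - lookup p i ∣

  n : ℕ
  n = sumℕ len

  σp : ℤ
  σp = sumℤ (lookup p)

  -- I = { σp + j | j < n };  rank s = #{ t ∈ I | t ≺ s }
  rank : ℤ → ℕ
  rank s = count n (λ j → (σp ℤ.+ + j) ≺? s)

  -- s ∈ I_i  (I_1 holds the len 1 ≺-smallest elements, ..., I_d the len d ≺-greatest)
  InBlock : Fin d → ℤ → Set
  InBlock i s = (cum len i ℕ.≤ rank s) × (rank s ℕ.< cum len i ℕ.+ len i)

  InBlock? : (i : Fin d) (s : ℤ) → Dec (InBlock i s)
  InBlock? i s = (cum len i ℕ.≤? rank s) ×-dec (rank s ℕ.<? cum len i ℕ.+ len i)

  -- the point reached after k steps: the i-th coordinate grew by the number of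
  -- earlier steps j < k (taken at a point of coordinate sum σp + j) whose
  -- direction was i, i.e. with σp + j ∈ I_i.
  step : ℕ → Pt d
  step k = tabulate λ i →
    lookup p i ℤ.+ + count k (λ j → InBlock? i (σp ℤ.+ + j))

  InS : Pt d → Set
  InS r = Σ ℕ λ k → (k ℕ.≤ n) × (step k ≡ r)

Seg : {_≺_ : Rel ℤ 0ℓ} → Decidable _≺_ → ∀ {d} → Pt d → Pt d → Pt d → Set
Seg ≺? p q r = (p ≤ₚ q × Walk.InS ≺? p q r) ⊎ (q ≤ₚ p × Walk.InS ≺? q p r)

-- The walk from p to q (p ≤ q) takes its j-th step in direction i iff the ≺-rank of the coordinate
-- sum σ + j (σ the coordinate sum of p) among σ, …, σ + n - 1 lies in the i-th block of sizes
-- q₁ - p₁, …, q_d - p_d.  If a direction sequence β is ≺-monotone along σ, σ + 1, … and uses each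
-- direction i exactly q_i - p_i times, the rank of σ + j is at least the number of steps in
-- directions before β j and below that number plus the steps in direction β j; so the walk is the
-- trace of β.  Segments are therefore exactly the traces of ≺-monotone direction sequences.
-- Restrictions and shifts of monotone sequences are monotone, which gives (S3); a monotone sequence
-- extends at either end by placing the new coordinate sum σ + n, resp. σ - 1, into the ≺-order of
-- the old ones, which gives (S4); (S1), (S2) and (S5) are bookkeeping.

module Submission where

open import Defs
open import Level using (0ℓ)
open import Data.Nat using (ℕ; zero; suc; _+_; _∸_; _≤_; _<_; z≤n; s≤s; _≟_; _<?_)
open import Data.Nat.Properties
open import Data.Bool using (if_then_else_)
open import Data.Empty using (⊥-elim)
open import Data.Fin as Fin using (Fin; toℕ)
import Data.Fin.Properties as Fin
open import Algebra.Properties.CommutativeSemigroup +-commutativeSemigroup using (interchange)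
open import Data.Integer as ℤ using (ℤ; +_; ∣_∣)
import Data.Integer.Properties as ℤP
open import Data.Integer.Tactic.RingSolver using (solve-∀)
open import Algebra.Properties.AbelianGroup ℤP.+-0-abelianGroup using (∙-cancelˡ)
open import Algebra.Properties.CommutativeSemigroup ℤP.+-commutativeSemigroup
  using () renaming (interchange to ℤ-interchange)
open import Data.Vec using (lookup; tabulate)
open import Data.Vec.Properties using (lookup∘tabulate; tabulate∘lookup; tabulate-cong)
open import Data.Product using (Σ; ∃; _×_; _,_; proj₁; proj₂)
open import Data.Sum using (_⊎_; inj₁; inj₂; swap)
open import Function using (_∘_; _⇔_; mk⇔; Injective; Equivalence)
open import Function.Construct.Composition using (_⇔-∘_)
open import Function.Construct.Symmetry using (⇔-sym)
open import Relation.Nullary using (¬_; Dec; yes; no; does)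
open import Relation.Nullary.Decidable using (_×-dec_; ¬?)
open import Relation.Binary using (Rel; IsStrictTotalOrder; tri<; tri≈; tri>)
open import Relation.Binary.PropositionalEquality

private
  variable
    d : ℕ
    P Q : ℕ → Set

-- Counting

indicator : ∀ {A : Set} → Dec A → ℕ
indicator A? = if does A? then 1 else 0

indicator-yes : ∀ {A : Set} (A? : Dec A) → A → indicator A? ≡ 1
indicator-yes (yes _) _ = refl
indicator-yes (no ¬a) a = ⊥-elim (¬a a)

indicator-no : ∀ {A : Set} (A? : Dec A) → ¬ A → indicator A? ≡ 0
indicator-no (yes a) ¬a = ⊥-elim (¬a a)
indicator-no (no _) _ = refl

count-suc : ∀ n (P? : ∀ j → Dec (P j)) → count (suc n) P? ≡ indicator (P? n) + count n P?
count-suc n P? with P? n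
... | yes _ = refl
... | no _ = refl

restrict : ∀ {n} {X : ℕ → Set} → (∀ {j} → j < suc n → X j) → (∀ {j} → j < n → X j)
restrict h = h ∘ m<n⇒m<1+n

count≤n : ∀ n (P? : ∀ j → Dec (P j)) → count n P? ≤ n
count≤n zero P? = z≤n
count≤n (suc n) P? with P? n
... | yes _ = s≤s (count≤n n P?)
... | no _ = m≤n⇒m≤1+n (count≤n n P?)

count-none : ∀ n (P? : ∀ j → Dec (P j)) → (∀ {j} → j < n → ¬ P j) → count n P? ≡ 0
count-none zero P? none = refl
count-none (suc n) P? none with P? n
... | yes pn = ⊥-elim (none (n<1+n n) pn)
... | no _ = count-none n P? (restrict none)

count-+ : ∀ k m (P? : ∀ j → Dec (P j)) → count (k + m) P? ≡ count k P? + count m (λ j → P? (k + j))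
count-+ k zero P? = trans (cong (λ n → count n P?) (+-identityʳ k)) (sym (+-identityʳ _))
count-+ k (suc m) P? rewrite +-suc k m with P? (k + m)
... | yes _ = trans (cong suc (count-+ k m P?)) (sym (+-suc _ _))
... | no _ = count-+ k m P?

count-cong : ∀ n (P? : ∀ j → Dec (P j)) (Q? : ∀ j → Dec (Q j)) →
             (∀ {j} → j < n → P j → Q j) → (∀ {j} → j < n → Q j → P j) → count n P? ≡ count n Q?
count-cong zero P? Q? f g = refl
count-cong (suc n) P? Q? f g with P? n | Q? n
... | yes _ | yes _ = cong suc (count-cong n P? Q? (restrict f) (restrict g))
... | yes p | no ¬q = ⊥-elim (¬q (f (n<1+n n) p))
... | no ¬p | yes q = ⊥-elim (¬p (g (n<1+n n) q))
... | no _ | no _ = count-cong n P? Q? (restrict f) (restrict g)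

count-mono : ∀ n (P? : ∀ j → Dec (P j)) (Q? : ∀ j → Dec (Q j)) →
             (∀ {j} → j < n → P j → Q j) → count n P? ≤ count n Q?
count-mono zero P? Q? f = z≤n
count-mono (suc n) P? Q? f with P? n | Q? n
... | yes _ | yes _ = s≤s (count-mono n P? Q? (restrict f))
... | yes p | no ¬q = ⊥-elim (¬q (f (n<1+n n) p))
... | no _ | yes _ = m≤n⇒m≤1+n (count-mono n P? Q? (restrict f))
... | no _ | no _ = count-mono n P? Q? (restrict f)

count-mono-< : ∀ n (P? : ∀ j → Dec (P j)) (Q? : ∀ j → Dec (Q j)) → (∀ {j} → j < n → P j → Q j) →
               ∀ {j₀} → j₀ < n → Q j₀ → ¬ P j₀ → count n P? < count n Q?
count-mono-< (suc n) P? Q? f {j₀} j₀<1+n qj₀ ¬pj₀ with P? n | Q? n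
... | yes p | yes _ = s≤s (count-mono-< n P? Q? (restrict f) (≤∧≢⇒< (≤-pred j₀<1+n) (λ { refl → ¬pj₀ p })) qj₀ ¬pj₀)
... | yes p | no ¬q = ⊥-elim (¬q (f (n<1+n n) p))
... | no _  | yes _ = s≤s (count-mono n P? Q? (restrict f))
... | no _  | no ¬q = count-mono-< n P? Q? (restrict f) (≤∧≢⇒< (≤-pred j₀<1+n) (λ { refl → ¬q qj₀ })) qj₀ ¬pj₀

count-partition : ∀ n (P? : ∀ j → Dec (P j)) (Q? : ∀ j → Dec (Q j)) →
                  count n P? ≡ count n (λ j → P? j ×-dec Q? j) + count n (λ j → P? j ×-dec ¬? (Q? j))
count-partition zero P? Q? = refl
count-partition (suc n) P? Q? with P? n | Q? n
... | yes _ | yes _ = cong suc (count-partition n P? Q?)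
... | yes _ | no _  = trans (cong suc (count-partition n P? Q?)) (sym (+-suc _ _))
... | no _  | _     = count-partition n P? Q?

count≤1 : ∀ n (P? : ∀ j → Dec (P j)) → (∀ {j j′} → j < n → j′ < n → P j → P j′ → j ≡ j′) → count n P? ≤ 1
count≤1 zero P? unique = z≤n
count≤1 (suc n) P? unique with P? n
... | yes pn = s≤s (≤-reflexive (count-none n P? λ j<n pj → <⇒≢ j<n (unique (m<n⇒m<1+n j<n) (n<1+n n) pj pn)))
... | no _ = count≤1 n P? λ j<n j′<n → unique (m<n⇒m<1+n j<n) (m<n⇒m<1+n j′<n)

count-pigeonhole : ∀ m {n lo} (f : ℕ → ℕ) (P? : ∀ j → Dec (P j)) →
                   (∀ {j j′} → j < n → j′ < n → P j → P j′ → f j ≡ f j′ → j ≡ j′) →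
                   (∀ {j} → j < n → P j → lo ≤ f j × f j < lo + m) → count n P? ≤ m
count-pigeonhole zero {n} {lo} f P? inj range = ≤-reflexive (count-none n P? λ j<n pj →
  let lo≤fj , fj<lo+0 = range j<n pj in <⇒≱ (subst (_ <_) (+-identityʳ lo) fj<lo+0) lo≤fj)
count-pigeonhole (suc m) {n} {lo} f P? inj range = begin
  count n P?                               ≡⟨ count-partition n P? (λ j → f j ≟ lo + m) ⟩
  count n (λ j → P? j ×-dec (f j ≟ lo + m))
    + count n (λ j → P? j ×-dec ¬? (f j ≟ lo + m)) ≤⟨ +-mono-≤ top rest ⟩
  1 + m                                    ∎
  where
  open ≤-Reasoning
  top : count n (λ j → P? j ×-dec (f j ≟ lo + m)) ≤ 1
  top = count≤1 n _ λ j<n j′<n (pj , fj≡) (pj′ , fj′≡) → inj j<n j′<n pj pj′ (trans fj≡ (sym fj′≡))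
  rest : count n (λ j → P? j ×-dec ¬? (f j ≟ lo + m)) ≤ m
  rest = count-pigeonhole m {n} f _ (λ j<n j′<n (pj , _) (pj′ , _) → inj j<n j′<n pj pj′)
    λ {j} j<n (pj , fj≢) → let lo≤fj , fj<top = range j<n pj in
      lo≤fj , ≤∧≢⇒< (≤-pred (subst (f j <_) (+-suc lo m) fj<top)) fj≢

-- Finite sums and blocks

sumℕ-cong : {f g : Fin d → ℕ} → (∀ i → f i ≡ g i) → sumℕ f ≡ sumℕ g
sumℕ-cong {zero} f≗g = refl
sumℕ-cong {suc d} f≗g = cong₂ _+_ (f≗g Fin.zero) (sumℕ-cong (f≗g ∘ Fin.suc))

sumℕ-zero : sumℕ {d} (λ _ → 0) ≡ 0
sumℕ-zero {zero} = refl
sumℕ-zero {suc d} = sumℕ-zero {d}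

sumℕ-+ : (f g : Fin d → ℕ) → sumℕ (λ i → f i + g i) ≡ sumℕ f + sumℕ g
sumℕ-+ {zero} f g = refl
sumℕ-+ {suc d} f g = trans (cong (_+_ (f Fin.zero + g Fin.zero)) (sumℕ-+ (f ∘ Fin.suc) (g ∘ Fin.suc)))
  (interchange (f Fin.zero) (g Fin.zero) (sumℕ (f ∘ Fin.suc)) (sumℕ (g ∘ Fin.suc)))

sumℕ-mono : {f g : Fin d → ℕ} → (∀ i → f i ≤ g i) → sumℕ f ≤ sumℕ g
sumℕ-mono {zero} f≤g = z≤n
sumℕ-mono {suc d} f≤g = +-mono-≤ (f≤g Fin.zero) (sumℕ-mono (f≤g ∘ Fin.suc))

sumℕ≡∧≤⇒≡ : {f g : Fin d → ℕ} → (∀ i → f i ≤ g i) → sumℕ f ≡ sumℕ g → ∀ i → f i ≡ g i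
sumℕ≡∧≤⇒≡ {f = f} {g} f≤g Σf≡Σg Fin.zero = ≤-antisym (f≤g Fin.zero)
  (+-cancelʳ-≤ (sumℕ (f ∘ Fin.suc)) _ _
    (≤-trans (+-monoʳ-≤ (g Fin.zero) (sumℕ-mono (f≤g ∘ Fin.suc))) (≤-reflexive (sym Σf≡Σg))))
sumℕ≡∧≤⇒≡ {f = f} {g} f≤g Σf≡Σg (Fin.suc i) = sumℕ≡∧≤⇒≡ (f≤g ∘ Fin.suc)
  (+-cancelˡ-≡ (f Fin.zero) _ _ (trans Σf≡Σg (cong (_+ sumℕ (g ∘ Fin.suc)) (sym f₀≡g₀)))) i
  where
  f₀≡g₀ : f Fin.zero ≡ g Fin.zero
  f₀≡g₀ = sumℕ≡∧≤⇒≡ f≤g Σf≡Σg Fin.zero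

cum-cong : {f g : Fin d → ℕ} → (∀ i → f i ≡ g i) → ∀ b → cum f b ≡ cum g b
cum-cong f≗g Fin.zero = refl
cum-cong f≗g (Fin.suc b) = cong₂ _+_ (f≗g Fin.zero) (cum-cong (f≗g ∘ Fin.suc) b)

cum-zero : (b : Fin d) → cum (λ _ → 0) b ≡ 0
cum-zero Fin.zero = refl
cum-zero (Fin.suc b) = cum-zero b

cum-+ : (f g : Fin d → ℕ) (b : Fin d) → cum (λ i → f i + g i) b ≡ cum f b + cum g b
cum-+ f g Fin.zero = refl
cum-+ f g (Fin.suc b) = trans (cong (_+_ (f Fin.zero + g Fin.zero)) (cum-+ (f ∘ Fin.suc) (g ∘ Fin.suc) b))
  (interchange (f Fin.zero) (g Fin.zero) (cum (f ∘ Fin.suc) b) (cum (g ∘ Fin.suc) b))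

cum+≤cum : (L : Fin d → ℕ) {i i′ : Fin d} → i Fin.< i′ → cum L i + L i ≤ cum L i′
cum+≤cum L {Fin.zero} {Fin.suc i′} _ = m≤m+n (L Fin.zero) _
cum+≤cum L {Fin.suc i} {Fin.suc i′} (s≤s i<i′) =
  ≤-trans (≤-reflexive (+-assoc (L Fin.zero) _ _)) (+-monoʳ-≤ (L Fin.zero) (cum+≤cum (L ∘ Fin.suc) i<i′))

unit : Fin d → Fin d → ℕ
unit x i = indicator (x Fin.≟ i)

sumℕ-unit : (x : Fin d) → sumℕ (unit x) ≡ 1
sumℕ-unit {suc d} Fin.zero = cong suc (sumℕ-zero {d})
sumℕ-unit (Fin.suc x) = sumℕ-unit x

cum-unit : (x b : Fin d) → cum (unit x) b ≡ indicator (x Fin.<? b)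
cum-unit x Fin.zero = refl
cum-unit Fin.zero (Fin.suc b) = cong suc (cum-zero b)
cum-unit (Fin.suc x) (Fin.suc b) = cum-unit x b

Block : (L : Fin d → ℕ) → Fin d → ℕ → Set
Block L i r = cum L i ≤ r × r < cum L i + L i

block-unique : (L : Fin d → ℕ) {i i′ : Fin d} {r : ℕ} → Block L i r → Block L i′ r → i ≡ i′
block-unique L {i} {i′} (lo , hi) (lo′ , hi′) with Fin.<-cmp i i′
... | tri< i<i′ _ _ = ⊥-elim (<⇒≱ hi (≤-trans (cum+≤cum L i<i′) lo′))
... | tri≈ _ i≡i′ _ = i≡i′
... | tri> _ _ i′<i = ⊥-elim (<⇒≱ hi′ (≤-trans (cum+≤cum L i′<i) lo))

block-of : (L : Fin d → ℕ) {r : ℕ} → r < sumℕ L → ∃ λ i → Block L i r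
block-of {suc d} L {r} r<ΣL with r <? L Fin.zero
... | yes r<L₀ = Fin.zero , z≤n , r<L₀
... | no r≮L₀ = shift (block-of (L ∘ Fin.suc) (+-cancelˡ-< (L Fin.zero) _ _ (subst (_< sumℕ L) (sym r≡) r<ΣL)))
  where
  r≡ : L Fin.zero + (r ∸ L Fin.zero) ≡ r
  r≡ = m+[n∸m]≡n (≮⇒≥ r≮L₀)
  shift : (∃ λ i → Block (L ∘ Fin.suc) i (r ∸ L Fin.zero)) → ∃ λ i → Block L i r
  shift (i , lo , hi) = Fin.suc i , subst (_ ≤_) r≡ (+-monoʳ-≤ (L Fin.zero) lo) ,
                        subst₂ _<_ r≡ (sym (+-assoc (L Fin.zero) _ _)) (+-monoʳ-< (L Fin.zero) hi)

-- Monotone direction sequences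

occurrences : (ℕ → Fin d) → ℕ → Fin d → ℕ
occurrences β m i = count m (λ t → β t Fin.≟ i)

occurrences-suc : (β : ℕ → Fin d) (m : ℕ) (i : Fin d) → occurrences β (suc m) i ≡ unit (β m) i + occurrences β m i
occurrences-suc β m i = count-suc m (λ t → β t Fin.≟ i)

sumℕ-occurrences : (β : ℕ → Fin d) (m : ℕ) → sumℕ (occurrences β m) ≡ m
sumℕ-occurrences {d} β zero = sumℕ-zero {d}
sumℕ-occurrences β (suc m) = begin
  sumℕ (occurrences β (suc m))                        ≡⟨ sumℕ-cong (occurrences-suc β m) ⟩
  sumℕ (λ i → unit (β m) i + occurrences β m i)       ≡⟨ sumℕ-+ (unit (β m)) (occurrences β m) ⟩
  sumℕ (unit (β m)) + sumℕ (occurrences β m)          ≡⟨ cong₂ _+_ (sumℕ-unit (β m)) (sumℕ-occurrences β m) ⟩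
  suc m                                               ∎
  where open ≡-Reasoning

count-<-occurrences : (β : ℕ → Fin d) (m : ℕ) (b : Fin d) → count m (λ t → β t Fin.<? b) ≡ cum (occurrences β m) b
count-<-occurrences β zero b = sym (cum-zero b)
count-<-occurrences β (suc m) b = begin
  count (suc m) (λ t → β t Fin.<? b)
    ≡⟨ count-suc m (λ t → β t Fin.<? b) ⟩
  indicator (β m Fin.<? b) + count m (λ t → β t Fin.<? b)
    ≡⟨ cong₂ _+_ (sym (cum-unit (β m) b)) (count-<-occurrences β m b) ⟩
  cum (unit (β m)) b + cum (occurrences β m) b
    ≡⟨ cum-+ (unit (β m)) (occurrences β m) b ⟨
  cum (λ i → unit (β m) i + occurrences β m i) b
    ≡⟨ cum-cong (occurrences-suc β m) b ⟨
  cum (occurrences β (suc m)) b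
    ∎
  where open ≡-Reasoning

count-≤-occurrences : (β : ℕ → Fin d) (m : ℕ) (b : Fin d) →
                      count m (λ t → β t Fin.≤? b) ≡ cum (occurrences β m) b + occurrences β m b
count-≤-occurrences β m b = begin
  count m (λ t → β t Fin.≤? b)
    ≡⟨ count-partition m _ (λ t → β t Fin.<? b) ⟩
  count m (λ t → β t Fin.≤? b ×-dec β t Fin.<? b) + count m (λ t → β t Fin.≤? b ×-dec ¬? (β t Fin.<? b))
    ≡⟨ cong₂ _+_ below at ⟩
  count m (λ t → β t Fin.<? b) + occurrences β m b
    ≡⟨ cong (_+ occurrences β m b) (count-<-occurrences β m b) ⟩
  cum (occurrences β m) b + occurrences β m b
    ∎
  where
  open ≡-Reasoning
  below : count m (λ t → β t Fin.≤? b ×-dec β t Fin.<? b) ≡ count m (λ t → β t Fin.<? b)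
  below = count-cong m _ _ (λ _ → proj₂) (λ _ βt<b → <⇒≤ βt<b , βt<b)
  at : count m (λ t → β t Fin.≤? b ×-dec ¬? (β t Fin.<? b)) ≡ occurrences β m b
  at = count-cong m _ _ (λ _ (βt≤b , βt≮b) → Fin.≤-antisym βt≤b (≮⇒≥ βt≮b))
                        (λ { _ refl → ≤-refl , <-irrefl refl })

-- A record, so that u, m and β can be inferred from a proof of monotonicity.
record Monotone {A : Set} (_≺_ : Rel A 0ℓ) (u : ℕ → A) (m : ℕ) (β : ℕ → Fin d) : Set where
  constructor monotone
  field
    ≺⇒≤ : ∀ {j j′} → j < m → j′ < m → u j ≺ u j′ → β j Fin.≤ β j′
open Monotone

InsertionPoint : {A : Set} → Rel A 0ℓ → (ℕ → A) → ℕ → (ℕ → Fin d) → A → Fin d → Set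
InsertionPoint _≺_ u m β s e = (∀ {j} → j < m → u j ≺ s → β j Fin.≤ e) × (∀ {j} → j < m → s ≺ u j → e Fin.≤ β j)

cons : Fin d → (ℕ → Fin d) → ℕ → Fin d
cons e β zero = e
cons e β (suc j) = β j

<suc-cases : {X : ℕ → Set} {m : ℕ} → (∀ {j} → j < m → X j) → (∀ {j} → j ≡ m → X j) → ∀ {j} → j < suc m → X j
<suc-cases <m ≡m j<1+m with m<1+n⇒m<n∨m≡n j<1+m
... | inj₁ j<m = <m j<m
... | inj₂ j≡m = ≡m j≡m

snoc : (ℕ → Fin d) → ℕ → Fin d → ℕ → Fin d
snoc β m e j with j <? m
... | yes _ = β j
... | no _ = e

snoc-< : (β : ℕ → Fin d) {m j : ℕ} (e : Fin d) → j < m → snoc β m e j ≡ β j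
snoc-< β {m} {j} e j<m with j <? m
... | yes _ = refl
... | no j≮m = ⊥-elim (j≮m j<m)

snoc-≡ : (β : ℕ → Fin d) (m : ℕ) (e : Fin d) → snoc β m e m ≡ e
snoc-≡ β m e with m <? m
... | yes m<m = ⊥-elim (<-irrefl refl m<m)
... | no _ = refl

module _ {A : Set} {_≺_ : Rel A 0ℓ} (sto : IsStrictTotalOrder _≡_ _≺_) where
  open IsStrictTotalOrder sto using (compare; irrefl; asym) renaming (trans to ≺-trans)

  Monotone-≤ : {u : ℕ → A} {β : ℕ → Fin d} {k m : ℕ} → k ≤ m → Monotone _≺_ u m β → Monotone _≺_ u k β
  Monotone-≤ k≤m mono = monotone λ j<k j′<k → ≺⇒≤ mono (<-≤-trans j<k k≤m) (<-≤-trans j′<k k≤m)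

  Monotone-drop : {u : ℕ → A} {β : ℕ → Fin d} {k m : ℕ} → k ≤ m → Monotone _≺_ u m β →
                  Monotone _≺_ (λ j → u (k + j)) (m ∸ k) (λ j → β (k + j))
  Monotone-drop {k = k} {m} k≤m mono = monotone λ j<m∸k j′<m∸k → ≺⇒≤ mono (shift j<m∸k) (shift j′<m∸k)
    where
    shift : ∀ {j} → j < m ∸ k → k + j < m
    shift j< = subst (k + _ <_) (m+[n∸m]≡n k≤m) (+-monoʳ-< k j<)

  Monotone-resp : {u v : ℕ → A} {β : ℕ → Fin d} {m : ℕ} → (∀ j → u j ≡ v j) → Monotone _≺_ u m β → Monotone _≺_ v m β
  Monotone-resp u≗v mono =
    monotone λ j<m j′<m vj≺vj′ → ≺⇒≤ mono j<m j′<m (subst₂ _≺_ (sym (u≗v _)) (sym (u≗v _)) vj≺vj′)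

  Monotone-snoc : {u : ℕ → A} {β : ℕ → Fin d} {m : ℕ} {e : Fin d} → Monotone _≺_ u m β →
                  InsertionPoint _≺_ u m β (u m) e → Monotone _≺_ u (suc m) (snoc β m e)
  Monotone-snoc {u = u} {β} {m} {e} mono (lo , hi) = monotone snoc-≺⇒≤
    where
    snoc-≺⇒≤ : ∀ {j j′} → j < suc m → j′ < suc m → u j ≺ u j′ → snoc β m e j Fin.≤ snoc β m e j′
    snoc-≺⇒≤ j<1+m j′<1+m uj≺uj′ with m<1+n⇒m<n∨m≡n j<1+m | m<1+n⇒m<n∨m≡n j′<1+m
    ... | inj₁ j<m | inj₁ j′<m =
      subst₂ Fin._≤_ (sym (snoc-< β e j<m)) (sym (snoc-< β e j′<m)) (≺⇒≤ mono j<m j′<m uj≺uj′)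
    ... | inj₁ j<m | inj₂ refl = subst₂ Fin._≤_ (sym (snoc-< β e j<m)) (sym (snoc-≡ β m e)) (lo j<m uj≺uj′)
    ... | inj₂ refl | inj₁ j′<m = subst₂ Fin._≤_ (sym (snoc-≡ β m e)) (sym (snoc-< β e j′<m)) (hi j′<m uj≺uj′)
    ... | inj₂ refl | inj₂ refl = ⊥-elim (irrefl refl uj≺uj′)

  Monotone-cons : {u v : ℕ → A} {β : ℕ → Fin d} {m : ℕ} {s : A} {e : Fin d} → u zero ≡ s → (∀ j → u (suc j) ≡ v j) →
                  Monotone _≺_ v m β → InsertionPoint _≺_ v m β s e → Monotone _≺_ u (suc m) (cons e β)
  Monotone-cons {u = u} {v} {β} {m} {s} {e} u₀≡s u∘suc≗v mono (lo , hi) = monotone cons-≺⇒≤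
    where
    cons-≺⇒≤ : ∀ {j j′} → j < suc m → j′ < suc m → u j ≺ u j′ → cons e β j Fin.≤ cons e β j′
    cons-≺⇒≤ {zero} {zero} _ _ u₀≺u₀ = ⊥-elim (irrefl refl u₀≺u₀)
    cons-≺⇒≤ {zero} {suc j′} _ (s≤s j′<m) u₀≺u = hi j′<m (subst₂ _≺_ u₀≡s (u∘suc≗v j′) u₀≺u)
    cons-≺⇒≤ {suc j} {zero} (s≤s j<m) _ u≺u₀ = lo j<m (subst₂ _≺_ (u∘suc≗v j) u₀≡s u≺u₀)
    cons-≺⇒≤ {suc j} {suc j′} (s≤s j<m) (s≤s j′<m) u≺u = ≺⇒≤ mono j<m j′<m (subst₂ _≺_ (u∘suc≗v j) (u∘suc≗v j′) u≺u)

  insertion : (u : ℕ → A) (β : ℕ → Fin (suc d)) (m : ℕ) → Monotone _≺_ u m β → (s : A) →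
              ∃ λ e → InsertionPoint _≺_ u m β s e
  insertion u β zero mono s = Fin.zero , (λ ()) , (λ ())
  -- The new point is the larger of e and β m if u m ≺ s, the smaller if s ≺ u m, and e if u m ≡ s.
  insertion u β (suc m) mono s with insertion u β m (Monotone-≤ (n≤1+n m) mono) s | compare (u m) s
  ... | e , lo , hi | tri≈ _ um≡s _ =
    e , <suc-cases lo (λ { refl um≺s → ⊥-elim (irrefl um≡s um≺s) })
      , <suc-cases hi (λ { refl s≺um → ⊥-elim (irrefl (sym um≡s) s≺um) })
  ... | e , lo , hi | tri< um≺s _ _ with β m Fin.≤? e
  ...   | yes βm≤e =
    e , <suc-cases lo (λ { refl _ → βm≤e })
      , <suc-cases hi (λ { refl s≺um → ⊥-elim (asym um≺s s≺um) })
  ...   | no βm≰e =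
    β m , <suc-cases (λ j<m uj≺s → ≤-trans (lo j<m uj≺s) (<⇒≤ (≰⇒> βm≰e))) (λ { refl _ → ≤-refl })
        , <suc-cases (λ j<m s≺uj → ≺⇒≤ mono (n<1+n m) (m<n⇒m<1+n j<m) (≺-trans um≺s s≺uj))
                     (λ { refl s≺um → ⊥-elim (asym um≺s s≺um) })
  insertion u β (suc m) mono s | e , lo , hi | tri> _ _ s≺um with e Fin.≤? β m
  ...   | yes e≤βm =
    e , <suc-cases lo (λ { refl um≺s → ⊥-elim (asym um≺s s≺um) })
      , <suc-cases hi (λ { refl _ → e≤βm })
  ...   | no e≰βm =
    β m , <suc-cases (λ j<m uj≺s → ≺⇒≤ mono (m<n⇒m<1+n j<m) (n<1+n m) (≺-trans uj≺s s≺um))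
                     (λ { refl um≺s → ⊥-elim (asym um≺s s≺um) })
        , <suc-cases (λ j<m s≺uj → ≤-trans (<⇒≤ (≰⇒> e≰βm)) (hi j<m s≺uj)) (λ { refl _ → ≤-refl })

-- With u j = σp + j and L = len, rank and InBlock are definitionally Walk.rank and Walk.InBlock.
module RankedBlocks {A : Set} {_≺_ : Rel A 0ℓ} (sto : IsStrictTotalOrder _≡_ _≺_)
                    (u : ℕ → A) (u-injective : ∀ {j j′} → u j ≡ u j′ → j ≡ j′) (L : Fin d → ℕ) where
  open IsStrictTotalOrder sto using (compare; irrefl) renaming (trans to ≺-trans; _<?_ to _≺?_)

  rank : A → ℕ
  rank s = count (sumℕ L) (λ j → u j ≺? s)

  InBlock : Fin d → A → Set
  InBlock i s = Block L i (rank s)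

  rank-mono-< : ∀ {j j′} → j < sumℕ L → u j ≺ u j′ → rank (u j) < rank (u j′)
  rank-mono-< j<m uj≺uj′ = count-mono-< (sumℕ L) _ _ (λ _ ut≺uj → ≺-trans ut≺uj uj≺uj′) j<m uj≺uj′ (irrefl refl)

  rank-< : ∀ {j} → j < sumℕ L → rank (u j) < sumℕ L
  rank-< {j} j<m = <-≤-trans (count-mono-< (sumℕ L) _ (λ t → t <? sumℕ L) (λ t<m _ → t<m) j<m j<m (irrefl refl))
                             (count≤n (sumℕ L) _)

  rank-injective : ∀ {j j′} → j < sumℕ L → j′ < sumℕ L → rank (u j) ≡ rank (u j′) → j ≡ j′
  rank-injective {j} {j′} j<m j′<m rank≡ with compare (u j) (u j′)
  ... | tri< uj≺uj′ _ _ = ⊥-elim (<⇒≢ (rank-mono-< j<m uj≺uj′) rank≡)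
  ... | tri≈ _ uj≡uj′ _ = u-injective uj≡uj′
  ... | tri> _ _ uj′≺uj = ⊥-elim (<⇒≢ (rank-mono-< j′<m uj′≺uj) (sym rank≡))

  IsAssignment : (ℕ → Fin d) → Set
  IsAssignment β = Monotone _≺_ u (sumℕ L) β × (∀ i → occurrences β (sumℕ L) i ≡ L i)

  assignment-inBlock : ∀ {β j} → IsAssignment β → j < sumℕ L → InBlock (β j) (u j)
  assignment-inBlock {β} {j} (mono , occ≡L) j<m = lower , upper
    where
    b : Fin d
    b = β j
    m : ℕ
    m = sumℕ L
    open ≤-Reasoning
    lower : cum L b ≤ rank (u j)
    lower = begin
      cum L b                           ≡⟨ cum-cong occ≡L b ⟨
      cum (occurrences β m) b           ≡⟨ count-<-occurrences β m b ⟨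
      count m (λ t → β t Fin.<? b)      ≤⟨ count-mono m _ _ βt<b⇒ut≺uj ⟩
      rank (u j)                        ∎
      where
      βt<b⇒ut≺uj : ∀ {t} → t < m → β t Fin.< b → u t ≺ u j
      βt<b⇒ut≺uj {t} t<m βt<b with compare (u t) (u j)
      ... | tri< ut≺uj _ _ = ut≺uj
      ... | tri≈ _ ut≡uj _ = ⊥-elim (<-irrefl (cong (toℕ ∘ β) (u-injective ut≡uj)) βt<b)
      ... | tri> _ _ uj≺ut = ⊥-elim (<⇒≱ βt<b (≺⇒≤ mono j<m t<m uj≺ut))
    upper : rank (u j) < cum L b + L b
    upper = begin-strict
      rank (u j)
        <⟨ count-mono-< m _ (λ t → β t Fin.≤? b) (λ t<m ut≺uj → ≺⇒≤ mono t<m j<m ut≺uj) j<m ≤-refl (irrefl refl) ⟩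
      count m (λ t → β t Fin.≤? b)
        ≡⟨ count-≤-occurrences β m b ⟩
      cum (occurrences β m) b + occurrences β m b
        ≡⟨ cong₂ _+_ (cum-cong occ≡L b) (occ≡L b) ⟩
      cum L b + L b
        ∎

  assignment-inBlock⇔ : ∀ {β j} {i : Fin d} → IsAssignment β → j < sumℕ L → InBlock i (u j) ⇔ β j ≡ i
  assignment-inBlock⇔ isAssignment j<m =
    mk⇔ (block-unique L (assignment-inBlock isAssignment j<m)) (λ { refl → assignment-inBlock isAssignment j<m })

  -- i₀ is a junk value, used only for j ≥ sumℕ L.
  canonical : Fin d → ℕ → Fin d
  canonical i₀ j with rank (u j) <? sumℕ L
  ... | yes rank< = proj₁ (block-of L rank<)
  ... | no _ = i₀

  canonical-inBlock : ∀ i₀ {j} → j < sumℕ L → InBlock (canonical i₀ j) (u j)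
  canonical-inBlock i₀ {j} j<m with rank (u j) <? sumℕ L
  ... | yes rank< = proj₂ (block-of L rank<)
  ... | no rank≮ = ⊥-elim (rank≮ (rank-< j<m))

  canonical-isAssignment : ∀ i₀ → IsAssignment (canonical i₀)
  canonical-isAssignment i₀ = monotone ≺⇒≤-canonical , sumℕ≡∧≤⇒≡ occ≤L (sumℕ-occurrences β m)
    where
    β : ℕ → Fin d
    β = canonical i₀
    m : ℕ
    m = sumℕ L
    ≺⇒≤-canonical : ∀ {j j′} → j < m → j′ < m → u j ≺ u j′ → β j Fin.≤ β j′
    ≺⇒≤-canonical {j} {j′} j<m j′<m uj≺uj′ = ≮⇒≥ λ βj′<βj → <⇒≱ (rank-mono-< j<m uj≺uj′) (begin
      rank (u j′)                    <⟨ proj₂ (canonical-inBlock i₀ j′<m) ⟩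
      cum L (β j′) + L (β j′)        ≤⟨ cum+≤cum L βj′<βj ⟩
      cum L (β j)                    ≤⟨ proj₁ (canonical-inBlock i₀ j<m) ⟩
      rank (u j)                     ∎)
      where open ≤-Reasoning
    occ≤L : ∀ i → occurrences β m i ≤ L i
    occ≤L i = count-pigeonhole (L i) {m} {cum L i} (rank ∘ u) (λ t → β t Fin.≟ i)
      (λ j<m j′<m _ _ → rank-injective j<m j′<m)
      (λ { j<m refl → canonical-inBlock i₀ j<m })

-- Points and traces

lookup-extensionality : {x y : Pt d} → (∀ i → lookup x i ≡ lookup y i) → x ≡ y
lookup-extensionality {x = x} {y} x≗y = trans (sym (tabulate∘lookup x)) (trans (tabulate-cong x≗y) (tabulate∘lookup y))

+-pos-+ : ∀ a m n → a ℤ.+ + (m + n) ≡ (a ℤ.+ + m) ℤ.+ + n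
+-pos-+ a m n = trans (cong (ℤ._+_ a) (ℤP.pos-+ m n)) (sym (ℤP.+-assoc a (+ m) (+ n)))

sumℤ-cong : {f g : Fin d → ℤ} → (∀ i → f i ≡ g i) → sumℤ f ≡ sumℤ g
sumℤ-cong {zero} f≗g = refl
sumℤ-cong {suc d} f≗g = cong₂ ℤ._+_ (f≗g Fin.zero) (sumℤ-cong (f≗g ∘ Fin.suc))

sumℤ-+-sumℕ : (a : Fin d → ℤ) (b : Fin d → ℕ) → sumℤ (λ i → a i ℤ.+ + b i) ≡ sumℤ a ℤ.+ + sumℕ b
sumℤ-+-sumℕ {zero} a b = refl
sumℤ-+-sumℕ {suc d} a b = begin
  (a₀ ℤ.+ + b₀) ℤ.+ sumℤ (λ i → a (Fin.suc i) ℤ.+ + b (Fin.suc i))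
    ≡⟨ cong (ℤ._+_ (a₀ ℤ.+ + b₀)) (sumℤ-+-sumℕ (a ∘ Fin.suc) (b ∘ Fin.suc)) ⟩
  (a₀ ℤ.+ + b₀) ℤ.+ (sumℤ (a ∘ Fin.suc) ℤ.+ + sumℕ (b ∘ Fin.suc))
    ≡⟨ ℤ-interchange a₀ (+ b₀) _ _ ⟩
  (a₀ ℤ.+ sumℤ (a ∘ Fin.suc)) ℤ.+ (+ b₀ ℤ.+ + sumℕ (b ∘ Fin.suc))
    ≡⟨ cong (ℤ._+_ (a₀ ℤ.+ sumℤ (a ∘ Fin.suc))) (ℤP.pos-+ b₀ _) ⟨
  sumℤ a ℤ.+ + sumℕ b
    ∎
  where
  open ≡-Reasoning
  a₀ : ℤ
  a₀ = a Fin.zero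
  b₀ : ℕ
  b₀ = b Fin.zero

level : Pt d → ℕ → ℤ
level p j = sumℤ (lookup p) ℤ.+ + j

level-injective : (p : Pt d) {j j′ : ℕ} → level p j ≡ level p j′ → j ≡ j′
level-injective p eq = ℤP.+-injective (∙-cancelˡ (sumℤ (lookup p)) _ _ eq)

raise : Fin d → Pt d → Pt d
raise e x = tabulate (λ i → lookup x i ℤ.+ + unit e i)

lower : Fin d → Pt d → Pt d
lower e x = tabulate (λ i → lookup x i ℤ.- + unit e i)

raise-lower : (e : Fin d) (x : Pt d) → raise e (lower e x) ≡ x
raise-lower e x = lookup-extensionality λ i → begin
  lookup (raise e (lower e x)) i                          ≡⟨ lookup∘tabulate _ i ⟩
  lookup (lower e x) i ℤ.+ + unit e i                     ≡⟨ cong (ℤ._+ + unit e i) (lookup∘tabulate _ i) ⟩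
  (lookup x i ℤ.- + unit e i) ℤ.+ + unit e i              ≡⟨ minus-plus (lookup x i) (+ unit e i) ⟩
  lookup x i                                              ∎
  where
  open ≡-Reasoning
  minus-plus : ∀ a b → (a ℤ.- b) ℤ.+ b ≡ a
  minus-plus = solve-∀

lower-≤ₚ : (e : Fin d) (x : Pt d) → lower e x ≤ₚ x
lower-≤ₚ e x i = subst (ℤ._≤ lookup x i) (sym (lookup∘tabulate _ i)) (ℤP.i-j≤i (lookup x i) (+ unit e i))

Adj-raise : (e : Fin d) (x : Pt d) → Adj x (raise e x)
Adj-raise e x = e , moved , fixed
  where
  moved : ∣ lookup x e ℤ.- lookup (raise e x) e ∣ ≡ 1
  moved = begin
    ∣ lookup x e ℤ.- lookup (raise e x) e ∣
      ≡⟨ cong (λ y → ∣ lookup x e ℤ.- y ∣) (lookup∘tabulate _ e) ⟩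
    ∣ lookup x e ℤ.- (lookup x e ℤ.+ + unit e e) ∣
      ≡⟨ cong (λ n → ∣ lookup x e ℤ.- (lookup x e ℤ.+ + n) ∣) (indicator-yes (e Fin.≟ e) refl) ⟩
    ∣ lookup x e ℤ.- (lookup x e ℤ.+ + 1) ∣
      ≡⟨ cong ∣_∣ (minus-succ (lookup x e)) ⟩
    1
      ∎
    where
    open ≡-Reasoning
    minus-succ : ∀ a → a ℤ.- (a ℤ.+ + 1) ≡ ℤ.- + 1
    minus-succ = solve-∀
  fixed : ∀ j → j ≢ e → lookup x j ≡ lookup (raise e x) j
  fixed j j≢e = sym (begin
    lookup (raise e x) j           ≡⟨ lookup∘tabulate _ j ⟩
    lookup x j ℤ.+ + unit e j      ≡⟨ cong (λ n → lookup x j ℤ.+ + n) (indicator-no (e Fin.≟ j) (j≢e ∘ sym)) ⟩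
    lookup x j ℤ.+ + 0             ≡⟨ ℤP.+-identityʳ (lookup x j) ⟩
    lookup x j                     ∎)
    where open ≡-Reasoning

≤ₚ-raise : (e : Fin d) (x : Pt d) → x ≤ₚ raise e x
≤ₚ-raise e x i = subst (lookup x i ℤ.≤_) (sym (lookup∘tabulate _ i)) (ℤP.i≤i+j (lookup x i) (+ unit e i))

≤ₚ-antisym : {x y : Pt d} → x ≤ₚ y → y ≤ₚ x → x ≡ y
≤ₚ-antisym x≤y y≤x = lookup-extensionality λ i → ℤP.≤-antisym (x≤y i) (y≤x i)

Adj-sym : {x y : Pt d} → Adj x y → Adj y x
Adj-sym {x = x} {y} (i , moved , fixed) =
  i , trans (ℤP.∣i-j∣≡∣j-i∣ (lookup y i) (lookup x i)) moved , λ j j≢i → sym (fixed j j≢i)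

trace : Pt d → (ℕ → Fin d) → ℕ → Pt d
trace p β k = tabulate (λ i → lookup p i ℤ.+ + occurrences β k i)

module _ (p : Pt d) (β : ℕ → Fin d) where

  lookup-trace : ∀ k i → lookup (trace p β k) i ≡ lookup p i ℤ.+ + occurrences β k i
  lookup-trace k i = lookup∘tabulate _ i

  trace-zero : trace p β 0 ≡ p
  trace-zero = lookup-extensionality λ i → trans (lookup-trace 0 i) (ℤP.+-identityʳ (lookup p i))

  trace-suc : ∀ k → trace p β (suc k) ≡ raise (β k) (trace p β k)
  trace-suc k = tabulate-cong λ i → begin
    lookup p i ℤ.+ + occurrences β (suc k) i
      ≡⟨ cong (λ n → lookup p i ℤ.+ + n) (trans (occurrences-suc β k i) (+-comm (unit (β k) i) _)) ⟩
    lookup p i ℤ.+ + (occurrences β k i + unit (β k) i)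
      ≡⟨ +-pos-+ (lookup p i) _ _ ⟩
    (lookup p i ℤ.+ + occurrences β k i) ℤ.+ + unit (β k) i
      ≡⟨ cong (ℤ._+ + unit (β k) i) (lookup-trace k i) ⟨
    lookup (trace p β k) i ℤ.+ + unit (β k) i
      ∎
    where open ≡-Reasoning

  trace-+ : ∀ k k′ → trace (trace p β k) (λ j → β (k + j)) k′ ≡ trace p β (k + k′)
  trace-+ k k′ = tabulate-cong λ i → begin
    lookup (trace p β k) i ℤ.+ + occurrences (λ j → β (k + j)) k′ i
      ≡⟨ cong (ℤ._+ _) (lookup-trace k i) ⟩
    (lookup p i ℤ.+ + occurrences β k i) ℤ.+ + occurrences (λ j → β (k + j)) k′ i
      ≡⟨ +-pos-+ (lookup p i) _ _ ⟨
    lookup p i ℤ.+ + (occurrences β k i + occurrences (λ j → β (k + j)) k′ i)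
      ≡⟨ cong (λ n → lookup p i ℤ.+ + n) (count-+ k k′ _) ⟨
    lookup p i ℤ.+ + occurrences β (k + k′) i
      ∎
    where open ≡-Reasoning

  trace-adjacent : ∀ k → Adj (trace p β k) (trace p β (suc k))
  trace-adjacent k = subst (Adj (trace p β k)) (sym (trace-suc k)) (Adj-raise (β k) (trace p β k))

  ≤ₚ-trace : ∀ k → p ≤ₚ trace p β k
  ≤ₚ-trace k i = subst (lookup p i ℤ.≤_) (sym (lookup-trace k i)) (ℤP.i≤i+j (lookup p i) (+ occurrences β k i))

  sumℤ-trace : ∀ k → sumℤ (lookup (trace p β k)) ≡ level p k
  sumℤ-trace k = begin
    sumℤ (lookup (trace p β k))                       ≡⟨ sumℤ-cong (lookup-trace k) ⟩
    sumℤ (λ i → lookup p i ℤ.+ + occurrences β k i)   ≡⟨ sumℤ-+-sumℕ (lookup p) (occurrences β k) ⟩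
    sumℤ (lookup p) ℤ.+ + sumℕ (occurrences β k)      ≡⟨ cong (λ n → sumℤ (lookup p) ℤ.+ + n) (sumℕ-occurrences β k) ⟩
    level p k                                         ∎
    where open ≡-Reasoning

  trace-injective : ∀ {k k′} → trace p β k ≡ trace p β k′ → k ≡ k′
  trace-injective {k} {k′} eq =
    level-injective p (trans (sym (sumℤ-trace k)) (trans (cong (sumℤ ∘ lookup) eq) (sumℤ-trace k′)))

trace-cong : (p : Pt d) {β β′ : ℕ → Fin d} (k : ℕ) → (∀ {j} → j < k → β j ≡ β′ j) → trace p β k ≡ trace p β′ k
trace-cong p k β≗β′ = tabulate-cong λ i → cong (λ n → lookup p i ℤ.+ + n) (count-cong k _ _
  (λ j<k βj≡i → trans (sym (β≗β′ j<k)) βj≡i) (λ j<k β′j≡i → trans (β≗β′ j<k) β′j≡i))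

GridPath : Pt d → Pt d → (Pt d → Set) → Set
GridPath {d} p q V = Σ ℕ λ m → Σ (Fin (suc m) → Pt d) λ w →
  (w Fin.zero ≡ p) × (w (Fin.fromℕ m) ≡ q)
  × ((k : Fin m) → Adj (w (Fin.inject₁ k)) (w (Fin.suc k)))
  × Injective _≡_ _≡_ w
  × ((r : Pt d) → V r ⇔ (Σ (Fin (suc m)) λ k → w k ≡ r))

GridPath-resp : {p q : Pt d} {V W : Pt d → Set} → (∀ r → V r ⇔ W r) → GridPath p q V → GridPath p q W
GridPath-resp V⇔W (m , w , start , end , adjacent , injective , vertices) =
  m , w , start , end , adjacent , injective , λ r → vertices r ⇔-∘ ⇔-sym (V⇔W r)

GridPath-reverse : {p q : Pt d} {V : Pt d → Set} → GridPath p q V → GridPath q p V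
GridPath-reverse {d} {p} {q} {V} (m , w , start , end , adjacent , injective , vertices) =
  m , w ∘ Fin.opposite , end , trans (cong w (Fin.opposite-involutive Fin.zero)) start ,
  adjacent′ , (λ eq → opposite-injective (injective eq)) , vertices′
  where
  opposite-injective : ∀ {k k′ : Fin (suc m)} → Fin.opposite k ≡ Fin.opposite k′ → k ≡ k′
  opposite-injective {k} {k′} eq =
    trans (sym (Fin.opposite-involutive k)) (trans (cong Fin.opposite eq) (Fin.opposite-involutive k′))
  opposite-inject₁ : (k : Fin m) → Fin.opposite (Fin.inject₁ k) ≡ Fin.suc (Fin.opposite k)
  opposite-inject₁ k = Fin.toℕ-injective (begin
    toℕ (Fin.opposite (Fin.inject₁ k))   ≡⟨ Fin.opposite-prop (Fin.inject₁ k) ⟩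
    m ∸ toℕ (Fin.inject₁ k)              ≡⟨ cong (m ∸_) (Fin.toℕ-inject₁ k) ⟩
    m ∸ toℕ k                            ≡⟨ +-∸-assoc 1 (Fin.toℕ<n k) ⟩
    suc (m ∸ suc (toℕ k))                ≡⟨ cong suc (Fin.opposite-prop k) ⟨
    suc (toℕ (Fin.opposite k))           ∎)
    where open ≡-Reasoning
  adjacent′ : (k : Fin m) → Adj (w (Fin.opposite (Fin.inject₁ k))) (w (Fin.opposite (Fin.suc k)))
  adjacent′ k = subst (λ k′ → Adj (w k′) (w (Fin.inject₁ (Fin.opposite k)))) (sym (opposite-inject₁ k))
    (Adj-sym {x = w (Fin.inject₁ (Fin.opposite k))} {y = w (Fin.suc (Fin.opposite k))} (adjacent (Fin.opposite k)))
  vertices′ : (r : Pt d) → V r ⇔ (Σ (Fin (suc m)) λ k → w (Fin.opposite k) ≡ r)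
  vertices′ r = mk⇔ (λ (k , wk≡r) → Fin.opposite k , trans (cong w (Fin.opposite-involutive k)) wk≡r)
                    (λ (k , eq) → Fin.opposite k , eq)
                ⇔-∘ vertices r

module Segments {_≺_ : Rel ℤ 0ℓ} (sto : IsStrictTotalOrder _≡_ _≺_) where
  open IsStrictTotalOrder sto using () renaming (_<?_ to _≺?_)

  Segment : Pt d → Pt d → Pt d → Set
  Segment = Seg _≺?_

  module _ (p q : Pt d) where
    open Walk _≺?_ p q
    open RankedBlocks sto (level p) (level-injective p) len using (IsAssignment; assignment-inBlock⇔)

    step≡trace : ∀ {β k} → IsAssignment β → k ≤ n → step k ≡ trace p β k
    step≡trace {β} {k} isAssignment k≤n = tabulate-cong λ i → cong (λ c → lookup p i ℤ.+ + c)
      (count-cong k _ _ (λ j<k → Equivalence.to (assignment-inBlock⇔ isAssignment (<-≤-trans j<k k≤n)))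
                        (λ j<k → Equivalence.from (assignment-inBlock⇔ isAssignment (<-≤-trans j<k k≤n))))

    step-constant : ∀ {i} → lookup p i ≡ lookup q i → ∀ k → lookup (step k) i ≡ lookup p i
    step-constant {i} pᵢ≡qᵢ k = begin
      lookup (step k) i
        ≡⟨ lookup∘tabulate _ i ⟩
      lookup p i ℤ.+ + count k (λ j → InBlock? i (level p j))
        ≡⟨ cong (λ c → lookup p i ℤ.+ + c) (count-none k _ λ _ → empty) ⟩
      lookup p i ℤ.+ + 0
        ≡⟨ ℤP.+-identityʳ (lookup p i) ⟩
      lookup p i
        ∎
      where
      open ≡-Reasoning
      len≡0 : len i ≡ 0
      len≡0 = cong ∣_∣ (trans (cong (ℤ._- lookup p i) (sym pᵢ≡qᵢ)) (ℤP.+-inverseʳ (lookup p i)))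
      empty : ∀ {s} → ¬ InBlock i s
      empty (lo , hi) = <⇒≱ (subst (_ <_) (trans (cong (_+_ (cum len i)) len≡0) (+-identityʳ _)) hi) lo

  InS-trace⇔ : ∀ (p : Pt d) {β m} → Monotone _≺_ (level p) m β → ∀ x →
               Walk.InS _≺?_ p (trace p β m) x ⇔ (∃ λ k → k ≤ m × trace p β k ≡ x)
  InS-trace⇔ {d} p {β} {m} mono x =
    mk⇔ (λ (k , k≤n , stepₖ≡x) → k , subst (k ≤_) n≡m k≤n , trans (sym (step≡trace p q isAssignment k≤n)) stepₖ≡x)
        (λ (k , k≤m , traceₖ≡x) → k , k≤n k≤m , trans (step≡trace p q isAssignment (k≤n k≤m)) traceₖ≡x)
    where
    q : Pt d
    q = trace p β m
    open Walk _≺?_ p q using (len; n)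
    open RankedBlocks sto (level p) (level-injective p) len using (IsAssignment)
    len≡occurrences : ∀ i → len i ≡ occurrences β m i
    len≡occurrences i = cong ∣_∣ (trans (cong (ℤ._- lookup p i) (lookup-trace p β m i)) (plus-minus (lookup p i) _))
      where
      plus-minus : ∀ a b → (a ℤ.+ b) ℤ.- a ≡ b
      plus-minus = solve-∀
    n≡m : n ≡ m
    n≡m = trans (sumℕ-cong len≡occurrences) (sumℕ-occurrences β m)
    k≤n : ∀ {k} → k ≤ m → k ≤ n
    k≤n = subst (_ ≤_) (sym n≡m)
    isAssignment : IsAssignment β
    isAssignment = monotone (λ j<n j′<n → ≺⇒≤ mono (subst (_ <_) n≡m j<n) (subst (_ <_) n≡m j′<n)) ,
                   λ i → trans (cong (λ n → occurrences β n i) n≡m) (sym (len≡occurrences i))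

  ≤ₚ⇒monotone-trace : ∀ {d} {p q : Pt (suc d)} → p ≤ₚ q → ∃ λ β → ∃ λ m → Monotone _≺_ (level p) m β × trace p β m ≡ q
  ≤ₚ⇒monotone-trace {d} {p} {q} p≤q = β , n , proj₁ isAssignment , lookup-extensionality λ i → begin
    lookup (trace p β n) i
      ≡⟨ lookup-trace p β n i ⟩
    lookup p i ℤ.+ + occurrences β n i
      ≡⟨ cong (λ c → lookup p i ℤ.+ + c) (proj₂ isAssignment i) ⟩
    lookup p i ℤ.+ + ∣ lookup q i ℤ.- lookup p i ∣
      ≡⟨ cong (ℤ._+_ (lookup p i)) (trans (cong +_ (ℤP.∣i-j∣≡∣j-i∣ (lookup q i) (lookup p i))) (ℤP.∣-∣-≤ (p≤q i))) ⟩
    lookup p i ℤ.+ (lookup q i ℤ.- lookup p i)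
      ≡⟨ plus-minus (lookup p i) (lookup q i) ⟩
    lookup q i
      ∎
    where
    open Walk _≺?_ p q using (len; n)
    open RankedBlocks sto (level p) (level-injective p) len using (canonical; canonical-isAssignment)
    open ≡-Reasoning
    β : ℕ → Fin (suc d)
    β = canonical Fin.zero
    isAssignment : Monotone _≺_ (level p) n β × (∀ i → occurrences β n i ≡ len i)
    isAssignment = canonical-isAssignment Fin.zero
    plus-minus : ∀ a b → a ℤ.+ (b ℤ.- a) ≡ b
    plus-minus = solve-∀

  Segment⇔InS : ∀ {p q : Pt d} → p ≤ₚ q → ∀ x → Segment p q x ⇔ Walk.InS _≺?_ p q x
  Segment⇔InS {p = p} {q} p≤q x = mk⇔ to (λ inS → inj₁ (p≤q , inS))
    where
    to : Segment p q x → Walk.InS _≺?_ p q x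
    to (inj₁ (_ , inS)) = inS
    to (inj₂ (q≤p , inS)) with ≤ₚ-antisym {x = p} {y = q} p≤q q≤p
    ... | refl = inS

  Segment-trace⇔ : ∀ (p : Pt d) {β m} → Monotone _≺_ (level p) m β → ∀ x →
                   Segment p (trace p β m) x ⇔ (∃ λ k → k ≤ m × trace p β k ≡ x)
  Segment-trace⇔ p {β} {m} mono x = InS-trace⇔ p mono x ⇔-∘ Segment⇔InS {p = p} {trace p β m} (≤ₚ-trace p β m) x

  Segment-trace-path : ∀ (p : Pt d) {β m} → Monotone _≺_ (level p) m β →
                       GridPath p (trace p β m) (Segment p (trace p β m))
  Segment-trace-path {d} p {β} {m} mono =
    m , trace p β ∘ toℕ , trace-zero p β , cong (trace p β) (Fin.toℕ-fromℕ m) , adjacent , injective , vertices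
    where
    adjacent : (k : Fin m) → Adj (trace p β (toℕ (Fin.inject₁ k))) (trace p β (suc (toℕ k)))
    adjacent k = subst (λ j → Adj (trace p β j) (trace p β (suc (toℕ k)))) (sym (Fin.toℕ-inject₁ k))
                       (trace-adjacent p β (toℕ k))
    injective : Injective _≡_ _≡_ (trace p β ∘ toℕ)
    injective eq = Fin.toℕ-injective (trace-injective p β eq)
    vertices : (x : Pt d) → Segment p (trace p β m) x ⇔ (Σ (Fin (suc m)) λ k → trace p β (toℕ k) ≡ x)
    vertices x = mk⇔ toFin fromFin ⇔-∘ Segment-trace⇔ p mono x
      where
      toFin : (∃ λ k → k ≤ m × trace p β k ≡ x) → Σ (Fin (suc m)) λ k → trace p β (toℕ k) ≡ x
      toFin (k , k≤m , eq) = Fin.fromℕ< (s≤s k≤m) , trans (cong (trace p β) (Fin.toℕ-fromℕ< (s≤s k≤m))) eq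
      fromFin : (Σ (Fin (suc m)) λ k → trace p β (toℕ k) ≡ x) → ∃ λ k → k ≤ m × trace p β k ≡ x
      fromFin (k , eq) = toℕ k , ≤-pred (Fin.toℕ<n k) , eq

  Segment-trace-prefix : ∀ (p : Pt d) {β m k} → Monotone _≺_ (level p) m β → k ≤ m →
                         ∀ x → Segment p (trace p β k) x → Segment p (trace p β m) x
  Segment-trace-prefix p {β} {m} {k} mono k≤m x =
    Equivalence.from (Segment-trace⇔ p mono x) ∘ widen ∘ Equivalence.to (Segment-trace⇔ p (Monotone-≤ sto k≤m mono) x)
    where
    widen : (∃ λ k′ → k′ ≤ k × trace p β k′ ≡ x) → ∃ λ k′ → k′ ≤ m × trace p β k′ ≡ x
    widen (k′ , k′≤k , eq) = k′ , ≤-trans k′≤k k≤m , eq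

  Segment-trace-suffix : ∀ (p : Pt d) {β m k} → Monotone _≺_ (level p) m β → k ≤ m →
                         ∀ x → Segment (trace p β k) (trace p β m) x → Segment p (trace p β m) x
  Segment-trace-suffix {d} p {β} {m} {k} mono k≤m x x∈ = Equivalence.from (Segment-trace⇔ p mono x) (shift x∈′)
    where
    r : Pt d
    r = trace p β k
    β′ : ℕ → Fin d
    β′ j = β (k + j)
    q≡ : trace r β′ (m ∸ k) ≡ trace p β m
    q≡ = trans (trace-+ p β k (m ∸ k)) (cong (trace p β) (m+[n∸m]≡n k≤m))
    level≡ : ∀ j → level p (k + j) ≡ level r j
    level≡ j = trans (+-pos-+ (sumℤ (lookup p)) k j) (cong (ℤ._+ + j) (sym (sumℤ-trace p β k)))
    mono′ : Monotone _≺_ (level r) (m ∸ k) β′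
    mono′ = Monotone-resp sto level≡ (Monotone-drop sto k≤m mono)
    x∈′ : ∃ λ k′ → k′ ≤ m ∸ k × trace r β′ k′ ≡ x
    x∈′ = Equivalence.to (Segment-trace⇔ r mono′ x) (subst (λ q → Segment r q x) (sym q≡) x∈)
    shift : (∃ λ k′ → k′ ≤ m ∸ k × trace r β′ k′ ≡ x) → ∃ λ k″ → k″ ≤ m × trace p β k″ ≡ x
    shift (k′ , k′≤m∸k , eq) =
      k + k′ , subst (k + k′ ≤_) (m+[n∸m]≡n k≤m) (+-monoʳ-≤ k k′≤m∸k) , trans (sym (trace-+ p β k k′)) eq

  Segment-trace-extendʳ : ∀ {d} (p : Pt (suc d)) {β m} → Monotone _≺_ (level p) m β →
    Σ (Pt (suc d)) λ r → trace p β m ≤ₚ r × ¬ Segment p (trace p β m) r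
                         × (∀ x → Segment p (trace p β m) x → Segment p r x)
  Segment-trace-extendʳ {d} p {β} {m} mono = trace p β⁺ (suc m) , q≤r , r∉ , ⊆r
    where
    e : Fin (suc d)
    e = proj₁ (insertion sto (level p) β m mono (level p m))
    β⁺ : ℕ → Fin (suc d)
    β⁺ = snoc β m e
    mono⁺ : Monotone _≺_ (level p) (suc m) β⁺
    mono⁺ = Monotone-snoc sto mono (proj₂ (insertion sto (level p) β m mono (level p m)))
    agree : ∀ {k} → k ≤ m → trace p β⁺ k ≡ trace p β k
    agree k≤m = trace-cong p _ (λ j<k → snoc-< β e (<-≤-trans j<k k≤m))
    q≤r : trace p β m ≤ₚ trace p β⁺ (suc m)
    q≤r = subst₂ _≤ₚ_ (agree ≤-refl) (sym (trace-suc p β⁺ m)) (≤ₚ-raise (β⁺ m) (trace p β⁺ m))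
    r∉ : ¬ Segment p (trace p β m) (trace p β⁺ (suc m))
    r∉ = beyond ∘ Equivalence.to (Segment-trace⇔ p mono (trace p β⁺ (suc m)))
      where
      beyond : ¬ (∃ λ k → k ≤ m × trace p β k ≡ trace p β⁺ (suc m))
      beyond (k , k≤m , eq) = <⇒≱ (s≤s k≤m) (≤-reflexive (sym (trace-injective p β⁺ (trans (agree k≤m) eq))))
    ⊆r : ∀ x → Segment p (trace p β m) x → Segment p (trace p β⁺ (suc m)) x
    ⊆r x = Equivalence.from (Segment-trace⇔ p mono⁺ x) ∘ widen ∘ Equivalence.to (Segment-trace⇔ p mono x)
      where
      widen : (∃ λ k → k ≤ m × trace p β k ≡ x) → ∃ λ k → k ≤ suc m × trace p β⁺ k ≡ x
      widen (k , k≤m , eq) = k , m≤n⇒m≤1+n k≤m , trans (agree k≤m) eq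

  Segment-trace-extendˡ : ∀ {d} (p : Pt (suc d)) {β m} → Monotone _≺_ (level p) m β →
    Σ (Pt (suc d)) λ r′ → r′ ≤ₚ p × ¬ Segment p (trace p β m) r′
                          × (∀ x → Segment p (trace p β m) x → Segment r′ (trace p β m) x)
  Segment-trace-extendˡ {d} p {β} {m} mono = r′ , lower-≤ₚ e p , r′∉ , ⊆r′
    where
    s : ℤ
    s = sumℤ (lookup p) ℤ.- + 1
    e : Fin (suc d)
    e = proj₁ (insertion sto (level p) β m mono s)
    r′ : Pt (suc d)
    r′ = lower e p
    β⁻ : ℕ → Fin (suc d)
    β⁻ = cons e β
    r′-step : trace r′ β⁻ 1 ≡ p
    r′-step = trans (trace-suc r′ β⁻ 0) (trans (cong (raise e) (trace-zero r′ β⁻)) (raise-lower e p))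
    shifted : ∀ k → trace r′ β⁻ (suc k) ≡ trace p β k
    shifted k = trans (sym (trace-+ r′ β⁻ 1 k)) (cong (λ y → trace y β k) r′-step)
    σp≡ : sumℤ (lookup p) ≡ level r′ 1
    σp≡ = trans (cong (sumℤ ∘ lookup) (sym r′-step)) (sumℤ-trace r′ β⁻ 1)
    level-zero : level r′ 0 ≡ s
    level-zero = trans (plus-minus (sumℤ (lookup r′))) (cong (ℤ._- + 1) (sym σp≡))
      where
      plus-minus : ∀ a → a ℤ.+ + 0 ≡ (a ℤ.+ + 1) ℤ.- + 1
      plus-minus = solve-∀
    level-suc : ∀ j → level r′ (suc j) ≡ level p j
    level-suc j = trans (+-pos-+ (sumℤ (lookup r′)) 1 j) (cong (ℤ._+ + j) (sym σp≡))
    mono⁻ : Monotone _≺_ (level r′) (suc m) β⁻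
    mono⁻ = Monotone-cons sto level-zero level-suc mono (proj₂ (insertion sto (level p) β m mono s))
    r′∉ : ¬ Segment p (trace p β m) r′
    r′∉ = before ∘ Equivalence.to (Segment-trace⇔ p mono r′)
      where
      before : ¬ (∃ λ k → k ≤ m × trace p β k ≡ r′)
      before (k , _ , eq) =
        1+n≢0 (trace-injective r′ β⁻ {suc k} {0} (trans (shifted k) (trans eq (sym (trace-zero r′ β⁻)))))
    ⊆r′ : ∀ x → Segment p (trace p β m) x → Segment r′ (trace p β m) x
    ⊆r′ x = subst (λ q → Segment r′ q x) (shifted m) ∘ Equivalence.from (Segment-trace⇔ r′ mono⁻ x) ∘ shift
          ∘ Equivalence.to (Segment-trace⇔ p mono x)
      where
      shift : (∃ λ k → k ≤ m × trace p β k ≡ x) → ∃ λ k → k ≤ suc m × trace r′ β⁻ k ≡ x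
      shift (k , k≤m , eq) = suc k , s≤s k≤m , trans (shifted k) eq

  Segment-constant : ∀ (p q : Pt d) i → lookup p i ≡ lookup q i → ∀ r → Segment p q r → lookup r i ≡ lookup p i
  Segment-constant p q i pᵢ≡qᵢ r (inj₁ (_ , k , _ , stepₖ≡r)) =
    trans (cong (λ y → lookup y i) (sym stepₖ≡r)) (step-constant p q pᵢ≡qᵢ k)
  Segment-constant p q i pᵢ≡qᵢ r (inj₂ (_ , k , _ , stepₖ≡r)) =
    trans (cong (λ y → lookup y i) (sym stepₖ≡r)) (trans (step-constant q p (sym pᵢ≡qᵢ) k) (sym pᵢ≡qᵢ))

  Segment-path : ∀ {d} (p q : Pt (suc d)) → p ≤ₚ q → GridPath p q (Segment p q)
  Segment-path {d} p q p≤q = path (≤ₚ⇒monotone-trace {p = p} {q} p≤q)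
    where
    path : (∃ λ β → ∃ λ m → Monotone _≺_ (level p) m β × trace p β m ≡ q) → GridPath p q (Segment p q)
    path (β , m , mono , eq) = subst (λ q → GridPath p q (Segment p q)) eq (Segment-trace-path p {β} {m} mono)

  Segment-subsegments : ∀ {d} (p q : Pt (suc d)) → p ≤ₚ q → ∀ r → Segment p q r →
                        (∀ x → Segment p r x → Segment p q x) × (∀ x → Segment r q x → Segment p q x)
  Segment-subsegments {d} p q p≤q r = subsegments (≤ₚ⇒monotone-trace {p = p} {q} p≤q)
    where
    Sub : Pt (suc d) → Pt (suc d) → Set
    Sub r q = (∀ x → Segment p r x → Segment p q x) × (∀ x → Segment r q x → Segment p q x)
    subsegments : (∃ λ β → ∃ λ m → Monotone _≺_ (level p) m β × trace p β m ≡ q) → Segment p q r → Sub r q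
    subsegments (β , m , mono , eq) =
      subst (λ q → Segment p q r → Sub r q) eq (within ∘ Equivalence.to (Segment-trace⇔ p {β} {m} mono r))
      where
      within : (∃ λ k → k ≤ m × trace p β k ≡ r) → Sub r (trace p β m)
      within (k , k≤m , eq′) = subst (λ r → Sub r (trace p β m)) eq′
        (Segment-trace-prefix p {β} {m} {k} mono k≤m , Segment-trace-suffix p {β} {m} {k} mono k≤m)

  Segment-extensions : ∀ {d} (p q : Pt (suc d)) → p ≤ₚ q →
    (Σ (Pt (suc d)) λ r → q ≤ₚ r × ¬ Segment p q r × (∀ x → Segment p q x → Segment p r x))
    × (Σ (Pt (suc d)) λ r′ → r′ ≤ₚ p × ¬ Segment p q r′ × (∀ x → Segment p q x → Segment r′ q x))
  Segment-extensions {d} p q p≤q = extensions (≤ₚ⇒monotone-trace {p = p} {q} p≤q)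
    where
    Ext : Pt (suc d) → Set
    Ext q = (Σ (Pt (suc d)) λ r → q ≤ₚ r × ¬ Segment p q r × (∀ x → Segment p q x → Segment p r x))
            × (Σ (Pt (suc d)) λ r′ → r′ ≤ₚ p × ¬ Segment p q r′ × (∀ x → Segment p q x → Segment r′ q x))
    extensions : (∃ λ β → ∃ λ m → Monotone _≺_ (level p) m β × trace p β m ≡ q) → Ext q
    extensions (β , m , mono , eq) =
      subst Ext eq (Segment-trace-extendʳ p {β} {m} mono , Segment-trace-extendˡ p {β} {m} mono)

theorem7 : (d : ℕ) → 2 ≤ d → (_≺_ : Rel ℤ 0ℓ) → (sto : IsStrictTotalOrder _≡_ _≺_) →
    let S = Seg (IsStrictTotalOrder._<?_ sto) {d} in
    ((p q : Pt d) → p ≤ₚ q ⊎ q ≤ₚ p →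
      Σ ℕ λ m → Σ (Fin (suc m) → Pt d) λ w →
        (w Fin.zero ≡ p) × (w (Fin.fromℕ m) ≡ q)
        × ((k : Fin m) → Adj (w (Fin.inject₁ k)) (w (Fin.suc k)))
        × Injective _≡_ _≡_ w
        × ((r : Pt d) → S p q r ⇔ (Σ (Fin (suc m)) λ k → w k ≡ r)))
    × ((p q r : Pt d) → S p q r ⇔ S q p r)
    × ((p q : Pt d) → p ≤ₚ q → (r : Pt d) → S p q r →
        ((x : Pt d) → S p r x → S p q x) × ((x : Pt d) → S r q x → S p q x))
    × ((p q : Pt d) → p ≤ₚ q →
        (Σ (Pt d) λ r → q ≤ₚ r × ¬ S p q r × ((x : Pt d) → S p q x → S p r x))
        × (Σ (Pt d) λ r′ → r′ ≤ₚ p × ¬ S p q r′ × ((x : Pt d) → S p q x → S r′ q x)))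
    × ((p q : Pt d) (i : Fin d) → lookup p i ≡ lookup q i →
        (r : Pt d) → S p q r → lookup r i ≡ lookup p i)
theorem7 (suc d) _ _≺_ sto =
  path , symmetric , Segment-subsegments , Segment-extensions , Segment-constant
  where
  open Segments sto
  symmetric : (p q r : Pt (suc d)) → Segment p q r ⇔ Segment q p r
  symmetric p q r = mk⇔ swap swap
  path : (p q : Pt (suc d)) → p ≤ₚ q ⊎ q ≤ₚ p → GridPath p q (Segment p q)
  path p q (inj₁ p≤q) = Segment-path p q p≤q
  path p q (inj₂ q≤p) = GridPath-resp {p = p} {q} (symmetric q p) (GridPath-reverse {p = q} {p} (Segment-path q p q≤p))
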